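{- Let $\Sigma$ be a DB signature and $T$ a DB theory over $\Sigma$. If $\Sigma$ is acyclic, then $T$ has the finite model property (for constraint satisfiability).
   Context: A DB signature $\Sigma$ is a finite multi-sorted first-order signature with equality whose only non-logical symbols are unary function symbols $f:S\to S'$ and constants. A DB theory $T$ over $\Sigma$ is a set of universal $\Sigma$-sentences. The characteristic graph $G(\Sigma)$ is the directed edge-labelled graph whose nodes are the sorts of $\Sigma$, with an edge $S\xrightarrow{f}S'$ for every function symbol $f:S\to S'$; $\Sigma$ is acyclic if $G(\Sigma)$ is acyclic. The leaves of $G(\Sigma)$ (sorts with no outgoing edge) are partitioned into "unary relation" sorts and "value sorts"; all sorts that are not value sorts are called id sorts. A DB instance of $\langle\Sigma,T\rangle$ is a $\Sigma$-structure that is a model of $T$ and interprets every id sort as a finite set (value sorts may be infinite). A $\Sigma$-constraint is a conjunction of literals. $T$ has the finite model property (for constraint satisfiability) if every constraint (equivalently, existential formula $\exists \underline y\,\phi(\underline x,\underline y)$ with $\phi$ a constraint) that is satisfiable in some model of $T$ under some assignment is satisfiable in some DB instance of $\langle\Sigma,T\rangle$. -}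

module Defs where

open import Data.Nat using (ℕ)
open import Data.Fin using (Fin)
open import Data.Bool using (Bool; true; false)
open import Data.List using (List)
open import Data.List.Relation.Unary.All using (All)
open import Data.Product using (Σ; ∃; _×_; _,_)
open import Data.Sum using (_⊎_)
open import Data.Empty using (⊥)
open import Data.Unit using (⊤)
open import Relation.Nullary using (¬_)
open import Relation.Binary.PropositionalEquality using (_≡_; _≢_)
open import Relation.Binary.Structures using (IsEquivalence)

-- Leaves (sorts without outgoing edges) are split into value sorts
-- (isValue s ≡ true) and unary-relation sorts (the remaining leaves).

record DBSignature : Set where
  field
    nSorts  : ℕ
    nFuns   : ℕ
    nConsts : ℕ
    dom     : Fin nFuns → Fin nSorts
    cod     : Fin nFuns → Fin nSorts
    csort   : Fin nConsts → Fin nSorts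
    isValue : Fin nSorts → Bool
    value-leaf : ∀ s → isValue s ≡ true → ∀ f → dom f ≢ s

  Sort : Set
  Sort = Fin nSorts

  FunSym : Set
  FunSym = Fin nFuns

  ConstSym : Set
  ConstSym = Fin nConsts

  IdSort : Sort → Set
  IdSort s = isValue s ≡ false

open DBSignature public

module _ (sig : DBSignature) where

  data Path⁺ : Sort sig → Sort sig → Set where
    edge : (f : FunSym sig) → Path⁺ (dom sig f) (cod sig f)
    _◅_  : ∀ {t} (f : FunSym sig) → Path⁺ (cod sig f) t → Path⁺ (dom sig f) t

  Acyclic : Set
  Acyclic = ∀ s → ¬ Path⁺ s s

module _ (sig : DBSignature) where

  data Term {k : ℕ} (Γ : Fin k → Sort sig) : Sort sig → Set where
    var : (i : Fin k) → Term Γ (Γ i)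
    con : (c : ConstSym sig) → Term Γ (csort sig c)
    app : (f : FunSym sig) → Term Γ (dom sig f) → Term Γ (cod sig f)

  data QF {k : ℕ} (Γ : Fin k → Sort sig) : Set where
    eq   : ∀ {s} → Term Γ s → Term Γ s → QF Γ
    tt ff : QF Γ
    neg  : QF Γ → QF Γ
    and or imp : QF Γ → QF Γ → QF Γ

  record UnivSentence : Set where
    constructor ∀[_∶_]_
    field
      arity : ℕ
      ctx   : Fin arity → Sort sig
      body  : QF ctx

  DBTheory : Set₁
  DBTheory = UnivSentence → Set

  data Literal {k : ℕ} (Γ : Fin k → Sort sig) : Set where
    pos : ∀ {s} → Term Γ s → Term Γ s → Literal Γ
    negl : ∀ {s} → Term Γ s → Term Γ s → Literal Γ

  Constraint : {k : ℕ} → (Fin k → Sort sig) → Set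
  Constraint Γ = List (Literal Γ)

-- Semantics. Σ-structures with non-empty sort domains; the equality
-- symbol is interpreted by an equivalence relation respected by all
-- function symbols (setoid presentation of a structure).

record Structure (sig : DBSignature) : Set₁ where
  field
    Carrier  : Sort sig → Set
    _≈_      : ∀ {s} → Carrier s → Carrier s → Set
    ≈-equiv  : ∀ s → IsEquivalence (_≈_ {s})
    fun      : (f : FunSym sig) → Carrier (dom sig f) → Carrier (cod sig f)
    fun-cong : ∀ f {x y} → x ≈ y → fun f x ≈ fun f y
    const    : (c : ConstSym sig) → Carrier (csort sig c)
    inhabitant : (s : Sort sig) → Carrier s

open Structure public

module _ {sig : DBSignature} (M : Structure sig) where

  Assignment : {k : ℕ} → (Fin k → Sort sig) → Set
  Assignment {k} Γ = (i : Fin k) → Carrier M (Γ i)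

  eval : ∀ {k} {Γ : Fin k → Sort sig} {s} → Assignment Γ → Term sig Γ s → Carrier M s
  eval a (var i)   = a i
  eval a (con c)   = const M c
  eval a (app f t) = fun M f (eval a t)

  ⟦_⟧qf : ∀ {k} {Γ : Fin k → Sort sig} → QF sig Γ → Assignment Γ → Set
  ⟦ eq t u ⟧qf a    = _≈_ M (eval a t) (eval a u)
  ⟦ tt ⟧qf a        = ⊤
  ⟦ ff ⟧qf a        = ⊥
  ⟦ neg φ ⟧qf a     = ¬ ⟦ φ ⟧qf a
  ⟦ and φ ψ ⟧qf a   = ⟦ φ ⟧qf a × ⟦ ψ ⟧qf a
  ⟦ or φ ψ ⟧qf a    = ⟦ φ ⟧qf a ⊎ ⟦ ψ ⟧qf a
  ⟦ imp φ ψ ⟧qf a   = ⟦ φ ⟧qf a → ⟦ ψ ⟧qf a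

  _⊨_ : UnivSentence sig → Set
  _⊨_ (∀[ k ∶ Γ ] φ) = (a : Assignment Γ) → ⟦ φ ⟧qf a

  ⟦_⟧lit : ∀ {k} {Γ : Fin k → Sort sig} → Literal sig Γ → Assignment Γ → Set
  ⟦ pos t u ⟧lit a  = _≈_ M (eval a t) (eval a u)
  ⟦ negl t u ⟧lit a = ¬ (_≈_ M (eval a t) (eval a u))

  SatisfiesUnder : ∀ {k} {Γ : Fin k → Sort sig} → Constraint sig Γ → Assignment Γ → Set
  SatisfiesUnder φ a = All (λ ℓ → ⟦ ℓ ⟧lit a) φ

  FiniteSort : Sort sig → Set
  FiniteSort s = Σ ℕ λ n → Σ (Fin n → Carrier M s) λ e →
                   ∀ x → ∃ λ i → _≈_ M (e i) x

IsModel : ∀ {sig} → Structure sig → DBTheory sig → Set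
IsModel M T = ∀ σ → T σ → M ⊨ σ

IsDBInstance : ∀ {sig} → Structure sig → DBTheory sig → Set
IsDBInstance {sig} M T = IsModel M T × (∀ s → IdSort sig s → FiniteSort M s)

HasFMP : (sig : DBSignature) → DBTheory sig → Set₁
HasFMP sig T =
  ∀ {k} (Γ : Fin k → Sort sig) (φ : Constraint sig Γ) →
  (Σ (Structure sig) λ M → IsModel M T × Σ (Assignment M Γ) λ a → SatisfiesUnder M φ a) →
  Σ (Structure sig) λ D → IsDBInstance D T × Σ (Assignment D Γ) λ a → SatisfiesUnder D φ a

module Submission where

-- Let M be a model of T and a an assignment satisfying the constraint φ.
-- Form the term algebra Tm over the variables of φ, the constants, and
-- one fresh "default" symbol per sort (so that every sort is inhabited),
-- and interpret it in M via the evaluation map  ev : Tm → M  determined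
-- by a.  Declaring two terms equal when their values in M are equal
-- gives the inverse image D of M along ev.  Because ev commutes with all
-- function symbols and constants, D and M agree on every quantifier-free
-- formula under corresponding assignments; hence D is a model of T and
-- D, var ⊨ φ.  Finally, in an acyclic signature the sorts along the
-- spine of a term are pairwise distinct (a repetition yields a cycle in
-- the characteristic graph), so every term has depth below the number
-- of sorts, and the finitely many terms of bounded depth can be listed;
-- thus every sort of D is finite.

open import Defs
open import Data.Nat using (ℕ; zero; suc; _≤_; _<_; s≤s)
open import Data.Nat.Properties using (≰⇒>; <⇒≤)
open import Data.Fin using (Fin; zero; suc) renaming (_<_ to _<ᶠ_)
open import Data.Fin.Properties using (pigeonhole; _≟_)
open import Data.List using (List; []; _∷_; _++_; map; concatMap; allFin; length; lookup)
open import Data.List.Relation.Unary.All as All using ()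
open import Data.List.Relation.Unary.Any using (here; there; index)
open import Data.List.Relation.Unary.Any.Properties using (lookup-index)
open import Data.List.Membership.Propositional using (_∈_; lose)
open import Data.List.Membership.Propositional.Properties
  using (∈-allFin; ∈-map⁺; ∈-++⁺ˡ; ∈-++⁺ʳ; ∈-concatMap⁺)
open import Data.Product using (∃₂; _×_; _,_)
open import Data.Empty using (⊥)
open import Data.Sum using (_⊎_)
open import Function using (_∘_; id)
open import Relation.Nullary using (¬_; yes; no; contradiction)
open import Relation.Binary.PropositionalEquality
  using (_≡_; refl; sym; trans; cong; cong₂; subst; subst₂)
open import Relation.Binary.Structures using (IsEquivalence)

_++⁺_ : ∀ {sig a b c} → Path⁺ sig a b → Path⁺ sig b c → Path⁺ sig a c
edge f  ++⁺ q = f ◅ q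
(f ◅ p) ++⁺ q = f ◅ (p ++⁺ q)

∈-concatMap-intro : ∀ {A B : Set} (g : A → List B) {x : A} {xs : List A} {y : B} →
                    x ∈ xs → y ∈ g x → y ∈ concatMap g xs
∈-concatMap-intro g x∈xs y∈gx = ∈-concatMap⁺ g (lose x∈xs y∈gx)

listed⇒finite : ∀ {sig} (M : Structure sig) {s} (xs : List (Carrier M s)) →
                (∀ x → x ∈ xs) → FiniteSort M s
listed⇒finite M {s} xs complete =
  length xs , lookup xs , λ x →
    index (complete x) ,
    subst (_≈_ M (lookup xs (index (complete x)))) (sym (lookup-index (complete x)))
          (IsEquivalence.refl (≈-equiv M s))

module InverseImage {sig : DBSignature} (M : Structure sig)
  (C      : Sort sig → Set)
  (funC   : (f : FunSym sig) → C (dom sig f) → C (cod sig f))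
  (constC : (c : ConstSym sig) → C (csort sig c))
  (inhC   : (s : Sort sig) → C s)
  (h      : ∀ {s} → C s → Carrier M s)
  (h-fun   : ∀ f x → h (funC f x) ≡ fun M f (h x))
  (h-const : ∀ c → h (constC c) ≡ const M c)
  where

  module ≈M s = IsEquivalence (≈-equiv M s)

  D : Structure sig
  D = record
    { Carrier    = C
    ; _≈_        = λ x y → _≈_ M (h x) (h y)
    ; ≈-equiv    = λ s → record { refl = ≈M.refl s ; sym = ≈M.sym s ; trans = ≈M.trans s }
    ; fun        = funC
    ; fun-cong   = λ f {x} {y} x≈y →
        subst₂ (_≈_ M) (sym (h-fun f x)) (sym (h-fun f y)) (fun-cong M f x≈y)
    ; const      = constC
    ; inhabitant = inhC
    }

  h-eval : ∀ {k} {Δ : Fin k → Sort sig} {s} (b : Assignment D Δ) (t : Term sig Δ s) →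
           h (eval D b t) ≡ eval M (h ∘ b) t
  h-eval b (var i)   = refl
  h-eval b (con c)   = h-const c
  h-eval b (app f t) = trans (h-fun f _) (cong (fun M f) (h-eval b t))

  qf-transfer : ∀ {k} {Δ : Fin k → Sort sig} (b : Assignment D Δ) (ψ : QF sig Δ) →
                ⟦_⟧qf D ψ b ≡ ⟦_⟧qf M ψ (h ∘ b)
  qf-transfer b (eq t u)  = cong₂ (_≈_ M) (h-eval b t) (h-eval b u)
  qf-transfer b tt        = refl
  qf-transfer b ff        = refl
  qf-transfer b (neg ψ)   = cong ¬_ (qf-transfer b ψ)
  qf-transfer b (and ψ χ) = cong₂ _×_ (qf-transfer b ψ) (qf-transfer b χ)
  qf-transfer b (or ψ χ)  = cong₂ _⊎_ (qf-transfer b ψ) (qf-transfer b χ)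
  qf-transfer b (imp ψ χ) = cong₂ (λ A B → A → B) (qf-transfer b ψ) (qf-transfer b χ)

  model-transfer : (T : DBTheory sig) → IsModel M T → IsModel D T
  model-transfer T M⊨T (∀[ k ∶ Δ ] ψ) σ∈T b =
    subst id (sym (qf-transfer b ψ)) (M⊨T _ σ∈T (h ∘ b))

  literal-transfer : ∀ {k} {Δ : Fin k → Sort sig} (b : Assignment D Δ) (ℓ : Literal sig Δ) →
                     ⟦_⟧lit D ℓ b ≡ ⟦_⟧lit M ℓ (h ∘ b)
  literal-transfer b (pos t u)  = cong₂ (_≈_ M) (h-eval b t) (h-eval b u)
  literal-transfer b (negl t u) = cong ¬_ (cong₂ (_≈_ M) (h-eval b t) (h-eval b u))

  constraint-transfer : ∀ {k} {Δ : Fin k → Sort sig} (b : Assignment D Δ) (φ : Constraint sig Δ) →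
                        SatisfiesUnder M φ (h ∘ b) → SatisfiesUnder D φ b
  constraint-transfer b φ = All.map λ {ℓ} → subst id (sym (literal-transfer b ℓ))

module Terms (sig : DBSignature) {k : ℕ} (Γ : Fin k → Sort sig) where

  data Tm : Sort sig → Set where
    var : (i : Fin k) → Tm (Γ i)
    inh : (s : Sort sig) → Tm s
    con : (c : ConstSym sig) → Tm (csort sig c)
    app : (f : FunSym sig) → Tm (dom sig f) → Tm (cod sig f)

  depth : ∀ {s} → Tm s → ℕ
  depth (app f t) = suc (depth t)
  depth _         = zero

  sortAt : ∀ {s} (t : Tm s) → Fin (suc (depth t)) → Sort sig
  sortAt {s} t         zero    = s
  sortAt     (app f t) (suc i) = sortAt t i

  pathToRoot : ∀ {s} (t : Tm s) (j : Fin (depth t)) → Path⁺ sig (sortAt t (suc j)) s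
  pathToRoot (app f t) zero    = edge f
  pathToRoot (app f t) (suc j) = pathToRoot t j ++⁺ edge f

  spinePath : ∀ {s} (t : Tm s) {i j : Fin (suc (depth t))} →
              i <ᶠ j → Path⁺ sig (sortAt t j) (sortAt t i)
  spinePath t         {zero}  {suc j} _         = pathToRoot t j
  spinePath (app f t) {suc i} {suc j} (s≤s i<j) = spinePath t i<j

  -- In an acyclic signature no sort repeats along a spine, so by the
  -- pigeonhole principle a term is shallower than the number of sorts.
  depth-bound : Acyclic sig → ∀ {s} (t : Tm s) → depth t < nSorts sig
  depth-bound acyclic t = ≰⇒> λ N≤depth → repeat⇒cycle (pigeonhole (s≤s N≤depth) (sortAt t))
    where
    repeat⇒cycle : ∃₂ (λ i j → i <ᶠ j × sortAt t i ≡ sortAt t j) → ⊥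
    repeat⇒cycle (i , j , i<j , same) =
      acyclic (sortAt t i) (subst (λ x → Path⁺ sig x (sortAt t i)) (sym same) (spinePath t i<j))

  onSort : (s : Sort sig) {s' : Sort sig} → List (Tm s') → List (Tm s)
  onSort s {s'} ts with s' ≟ s
  ... | yes refl = ts
  ... | no  _    = []

  onSort-keeps : ∀ {s} {t : Tm s} {ts} → t ∈ ts → t ∈ onSort s ts
  onSort-keeps {s} t∈ts with s ≟ s
  ... | yes refl = t∈ts
  ... | no  s≢s  = contradiction refl s≢s

  atoms : (s : Sort sig) → List (Tm s)
  atoms s = concatMap (λ i → onSort s (var i ∷ [])) (allFin k)
         ++ inh s ∷ concatMap (λ c → onSort s (con c ∷ [])) (allFin (nConsts sig))

  terms : ℕ → (s : Sort sig) → List (Tm s)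
  terms zero    s = atoms s
  terms (suc d) s = atoms s
    ++ concatMap (λ f → onSort s (map (app f) (terms d (dom sig f)))) (allFin (nFuns sig))

  atoms-complete : ∀ {s} (t : Tm s) → depth t ≡ 0 → t ∈ atoms s
  atoms-complete (var i) _ =
    ∈-++⁺ˡ (∈-concatMap-intro _ (∈-allFin i) (onSort-keeps (here refl)))
  atoms-complete (inh s) _ = ∈-++⁺ʳ _ (here refl)
  atoms-complete (con c) _ =
    ∈-++⁺ʳ _ (there (∈-concatMap-intro _ (∈-allFin c) (onSort-keeps (here refl))))
  atoms-complete (app f t) ()

  atoms⊆terms : ∀ d {s} {t : Tm s} → t ∈ atoms s → t ∈ terms d s
  atoms⊆terms zero    t∈atoms = t∈atoms
  atoms⊆terms (suc d) t∈atoms = ∈-++⁺ˡ t∈atoms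

  terms-complete : ∀ d {s} (t : Tm s) → depth t ≤ d → t ∈ terms d s
  terms-complete zero    (app f t) ()
  terms-complete (suc d) (app f t) (s≤s t≤d) =
    ∈-++⁺ʳ (atoms _) (∈-concatMap-intro _ (∈-allFin f)
      (onSort-keeps (∈-map⁺ (app f) (terms-complete d t t≤d))))
  terms-complete d t@(var _) _ = atoms⊆terms d (atoms-complete t refl)
  terms-complete d t@(inh _) _ = atoms⊆terms d (atoms-complete t refl)
  terms-complete d t@(con _) _ = atoms⊆terms d (atoms-complete t refl)

  ev : (M : Structure sig) → Assignment M Γ → ∀ {s} → Tm s → Carrier M s
  ev M a (var i)   = a i
  ev M a (inh s)   = inhabitant M s
  ev M a (con c)   = const M c
  ev M a (app f t) = fun M f (ev M a t)

proposition3p4 : (sig : DBSignature) (T : DBTheory sig) → Acyclic sig → HasFMP sig T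
proposition3p4 sig T acyclic Γ φ (M , M⊨T , a , a⊨φ) =
  D , (model-transfer T M⊨T , λ s _ → finite s) , var , constraint-transfer var φ a⊨φ
  where
  open Terms sig Γ
  open InverseImage M Tm app con inh (ev M a) (λ _ _ → refl) (λ _ → refl)

  finite : ∀ s → FiniteSort D s
  finite s = listed⇒finite D (terms (nSorts sig) s)
    λ t → terms-complete (nSorts sig) t (<⇒≤ (depth-bound acyclic t))
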